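{- For every $n\ge1$, $\mathcal T_n\le\mathcal T_{n+1}$. In particular, the codes $\{\mathcal T_n : n\ge1\}$ form a chain under $\le$.
   Context: For $n\ge 1$, $\mathcal T_n\subseteq 2^{[2n]}$ is the code consisting of: the sets $\{2k-1,2k\}$ for $k=1,\dots,n$; the sets $\{1,3,\dots,2n-1\}$ and $\{2,4,\dots,2n\}$; all singletons; and $\emptyset$. For a code $\mathcal C$ and $\sigma$ a set of neurons, $\operatorname{Tk}_{\mathcal C}(\sigma)=\{c\in\mathcal C:\sigma\subseteq c\}$; a trunk of $\mathcal C$ is $\emptyset$ or of this form. A map $f:\mathcal C\to\mathcal D$ between codes is a morphism if the preimage of every trunk of $\mathcal D$ is a trunk of $\mathcal C$. $\mathcal C\le\mathcal D$ ($\mathcal C$ is a minor of $\mathcal D$) if there is a sequence $\mathcal D=\mathcal C_0,\dots,\mathcal C_k=\mathcal C$ such that each $\mathcal C_i$ is either the image of a surjective morphism from $\mathcal C_{i-1}$ or a trunk of $\mathcal C_{i-1}$ (up to isomorphism of codes). -}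

module Defs where

open import Data.Bool using (Bool; true; false; T; _∨_; not)
open import Data.Nat using (ℕ; zero; suc; _+_; _*_; _≤_; _%_; _/_; _≡ᵇ_)
open import Data.Fin using (Fin; toℕ)
open import Data.Fin.Subset using (Subset; _⊆_; ⁅_⁆; ⊥)
open import Data.Fin.Subset.Properties using (_⊆?_)
open import Data.Fin.Properties using (any?)
open import Data.Vec using (tabulate)
open import Data.Vec.Properties using (≡-dec)
import Data.Bool.Properties as BoolP
open import Data.Product using (Σ; Σ-syntax; proj₁; _,_)
open import Data.Sum using (_⊎_)
open import Relation.Nullary using (¬_; Dec; ⌊_⌋)
open import Relation.Binary.PropositionalEquality using (_≡_)
open import Function.Bundles using (_⇔_)

-- Codes on the neuron set [m] = Fin m (neuron i+1 of the paper is index i).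
-- A code is a subset of 2^[m], given by its (decidable) indicator.

Code : ℕ → Set
Code m = Subset m → Bool

Elem : ∀ {m} → Code m → Set
Elem {m} C = Σ (Subset m) (λ c → T (C c))

IsTrunk : ∀ {m} (C : Code m) → (Elem C → Set) → Set
IsTrunk {m} C P =
  (∀ c → ¬ P c) ⊎ Σ[ σ ∈ Subset m ] (∀ c → P c ⇔ (σ ⊆ proj₁ c))

-- f : C → D is a morphism if the preimage of every trunk of D is a trunk of C.
-- (preimage of the empty trunk is empty, hence automatically a trunk)
IsMorphism : ∀ {m n} (C : Code m) (D : Code n) → (Elem C → Elem D) → Set
IsMorphism {m} {n} C D f = ∀ (σ : Subset n) → IsTrunk C (λ c → σ ⊆ proj₁ (f c))

Surjective : ∀ {A B : Set} → (A → B) → Set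
Surjective {A} {B} f = ∀ (b : B) → Σ[ a ∈ A ] (f a ≡ b)

TkCode : ∀ {m} → Code m → Subset m → Code m
TkCode C σ c with C c
... | false = false
... | true  = ⌊ σ ⊆? c ⌋

EmptyCode : ∀ {m} → Code m
EmptyCode _ = false

-- Minors:  C ≤ᶜ D  iff there is a sequence D = C₀, …, C_k = C, each step being
-- the image of a surjective morphism (which also covers isomorphisms) or a trunk.
infix 4 _≤ᶜ_
data _≤ᶜ_ : ∀ {m n} → Code m → Code n → Set where
  base  : ∀ {m} {C : Code m} → C ≤ᶜ C
  morph : ∀ {m n k} {C : Code m} {D : Code n} {E : Code k}
          (f : Elem D → Elem E) → IsMorphism D E f → Surjective f →
          C ≤ᶜ E → C ≤ᶜ D
  trunk : ∀ {m n} {C : Code m} {D : Code n} (σ : Subset n) →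
          C ≤ᶜ TkCode D σ → C ≤ᶜ D
  emptyTrunk : ∀ {m n} {C : Code m} {D : Code n} →
          C ≤ᶜ EmptyCode {n} → C ≤ᶜ D

-- The code 𝒯ₙ on 2n neurons.  Paper neurons 2k-1, 2k (k = 1..n) are indices
-- 2k-2, 2k-1, i.e. the indices i with i / 2 = k-1.

pairSet : ∀ n → ℕ → Subset (n + n)
pairSet n j = tabulate (λ i → toℕ i / 2 ≡ᵇ j)

-- {1,3,…,2n-1} = even indices;  {2,4,…,2n} = odd indices
oddNeurons : ∀ n → Subset (n + n)
oddNeurons n = tabulate (λ i → toℕ i % 2 ≡ᵇ 0)

evenNeurons : ∀ n → Subset (n + n)
evenNeurons n = tabulate (λ i → toℕ i % 2 ≡ᵇ 1)

_≟ˢ_ : ∀ {m} (a b : Subset m) → Dec (a ≡ b)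
_≟ˢ_ = ≡-dec BoolP._≟_

𝒯 : ∀ n → Code (n + n)
𝒯 n c =
     ⌊ any? (λ (k : Fin n) → c ≟ˢ pairSet n (toℕ k)) ⌋
  ∨ ⌊ c ≟ˢ oddNeurons n ⌋
  ∨ ⌊ c ≟ˢ evenNeurons n ⌋
  ∨ ⌊ any? (λ (i : Fin (n + n)) → c ≟ˢ ⁅ i ⁆) ⌋
  ∨ ⌊ c ≟ˢ ⊥ ⌋

-- Deleting the last neurons is a morphism: the preimage of Tk(σ) under truncation to the
-- first 2m neurons is Tk(σ padded with outside). On 𝒯 n it lands in 𝒯 m, since the pairs,
-- singletons and half-sets of 𝒯 n truncate to those of 𝒯 m or to ∅, and every codeword of
-- 𝒯 m is hit. So 𝒯 m ≤ 𝒯 n whenever m ≤ n, and ≤ on ℕ is total.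

module Submission where

open import Defs
open import Data.Nat using (ℕ; suc; _≤_)
open import Data.Product using (_×_)
open import Data.Sum using (_⊎_)

open import Data.Bool using (Bool; false; T; _∨_)
open import Data.Bool.Properties using (T-∨; T-irrelevant)
open import Data.Nat using (zero; _+_; _*_; _<_; z≤n; s≤s; s≤s⁻¹; _/_; _%_; _≡ᵇ_; _≟_)
open import Data.Nat.Properties
  using (≤-total; n≤1+n; +-mono-≤; <-≤-trans; <⇒≢; *-comm; +-identityʳ)
open import Data.Nat.DivMod using (m<n*o⇒m/o<n)
open import Data.Fin using (Fin; toℕ; inject≤) renaming (zero to fzero; suc to fsuc)
open import Data.Fin.Properties using (toℕ<n; toℕ-inject≤; any?)
open import Data.Fin.Subset using (Subset; _⊆_; ⁅_⁆; ⊥; outside; inside)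
open import Data.Fin.Subset.Properties using (⊥⊆; drop-∷-⊆)
open import Data.Vec using ([]; _∷_; tabulate; truncate; padRight; here; there)
open import Data.Product using (Σ-syntax; ∃-syntax; _,_)
open import Data.Sum using (inj₁; inj₂)
import Data.Sum as Sum
open import Data.Sum.Function.Propositional using (_⊎-⇔_)
open import Function using (_∘_)
open import Function.Bundles using (_⇔_; mk⇔; Equivalence)
open import Function.Construct.Composition using (_⇔-∘_)
open import Function.Construct.Symmetry using (⇔-sym)
open import Relation.Nullary using (Dec; ⌊_⌋)
open import Relation.Nullary.Decidable using (toWitness; fromWitness; dec-false)
open import Relation.Binary.PropositionalEquality using (_≡_; refl; sym; trans; cong; cong₂; subst)

private variable
  m n : ℕ

elem-≡ : {C : Code m} {c d : Subset m} {c∈C : T (C c)} {d∈C : T (C d)} →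
         c ≡ d → _≡_ {A = Elem C} (c , c∈C) (d , d∈C)
elem-≡ refl = cong (_ ,_) (T-irrelevant _ _)

∷-⊆-cong : ∀ {x y} {p q : Subset m} {p′ q′ : Subset n} →
           p ⊆ q ⇔ p′ ⊆ q′ → (x ∷ p) ⊆ (y ∷ q) ⇔ (x ∷ p′) ⊆ (y ∷ q′)
∷-⊆-cong {x = x} {y} p⊆q⇔p′⊆q′ =
  mk⇔ (lift (Equivalence.to p⊆q⇔p′⊆q′)) (lift (Equivalence.from p⊆q⇔p′⊆q′))
  where
  lift : ∀ {m n} {p q : Subset m} {p′ q′ : Subset n} →
         (p ⊆ q → p′ ⊆ q′) → (x ∷ p) ⊆ (y ∷ q) → (x ∷ p′) ⊆ (y ∷ q′)
  lift f h here with h here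
  ... | here = here
  lift f h (there i∈p′) = there (f (drop-∷-⊆ h) i∈p′)

padRight-⊆⇔⊆-truncate : (m≤n : m ≤ n) (σ : Subset m) (c : Subset n) →
                        padRight m≤n outside σ ⊆ c ⇔ σ ⊆ truncate m≤n c
padRight-⊆⇔⊆-truncate z≤n [] c = mk⇔ (λ _ {_} ()) (λ _ {_} → ⊥⊆)
padRight-⊆⇔⊆-truncate (s≤s m≤n) (x ∷ σ) (y ∷ c) = ∷-⊆-cong (padRight-⊆⇔⊆-truncate m≤n σ c)

module Restriction {C : Code n} {D : Code m} (m≤n : m ≤ n)
                   (truncate-∈ : ∀ c → T (C c) → T (D (truncate m≤n c))) where

  restrict : Elem C → Elem D
  restrict (c , c∈C) = truncate m≤n c , truncate-∈ c c∈C

  restrict-isMorphism : IsMorphism C D restrict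
  restrict-isMorphism σ =
    inj₂ (padRight m≤n outside σ , λ (c , _) → ⇔-sym (padRight-⊆⇔⊆-truncate m≤n σ c))

  restrict-surjective : (∀ d → T (D d) → ∃[ c ] T (C c) × truncate m≤n c ≡ d) → Surjective restrict
  restrict-surjective onto (d , d∈D) with onto d d∈D
  ... | c , c∈C , c↦d = (c , c∈C) , elem-≡ c↦d

  restrict-≤ᶜ : (∀ d → T (D d) → ∃[ c ] T (C c) × truncate m≤n c ≡ d) → D ≤ᶜ C
  restrict-≤ᶜ onto = morph restrict restrict-isMorphism (restrict-surjective onto) base

tabulate-≡⊥ : {f : Fin n → Bool} → (∀ i → f i ≡ false) → tabulate f ≡ ⊥
tabulate-≡⊥ {zero} _ = refl
tabulate-≡⊥ {suc n} f≡false = cong₂ _∷_ (f≡false fzero) (tabulate-≡⊥ (f≡false ∘ fsuc))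

truncate-⊥ : (m≤n : m ≤ n) → truncate m≤n ⊥ ≡ ⊥
truncate-⊥ z≤n = refl
truncate-⊥ (s≤s m≤n) = cong (outside ∷_) (truncate-⊥ m≤n)

truncate-tabulate-toℕ : (m≤n : m ≤ n) (g : ℕ → Bool) →
                        truncate m≤n (tabulate (g ∘ toℕ)) ≡ tabulate (g ∘ toℕ)
truncate-tabulate-toℕ z≤n g = refl
truncate-tabulate-toℕ (s≤s m≤n) g = cong (g 0 ∷_) (truncate-tabulate-toℕ m≤n (g ∘ suc))

truncate-⁅inject≤⁆ : (m≤n : m ≤ n) (i : Fin m) → truncate m≤n ⁅ inject≤ i m≤n ⁆ ≡ ⁅ i ⁆
truncate-⁅inject≤⁆ (s≤s m≤n) fzero = cong (inside ∷_) (truncate-⊥ m≤n)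
truncate-⁅inject≤⁆ (s≤s m≤n) (fsuc i) = cong (outside ∷_) (truncate-⁅inject≤⁆ m≤n i)

truncate-⁅⁆-≥ : (m≤n : m ≤ n) (j : Fin n) → m ≤ toℕ j → truncate m≤n ⁅ j ⁆ ≡ ⊥
truncate-⁅⁆-≥ z≤n j _ = refl
truncate-⁅⁆-≥ (s≤s m≤n) (fsuc j) m≤j = cong (outside ∷_) (truncate-⁅⁆-≥ m≤n j (s≤s⁻¹ m≤j))

inject≤-or-≥ : (m≤n : m ≤ n) (j : Fin n) → (∃[ i ] inject≤ i m≤n ≡ j) ⊎ m ≤ toℕ j
inject≤-or-≥ z≤n j = inj₂ z≤n
inject≤-or-≥ (s≤s m≤n) fzero = inj₁ (fzero , refl)
inject≤-or-≥ (s≤s m≤n) (fsuc j) =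
  Sum.map (λ (i , e) → fsuc i , cong fsuc e) s≤s (inject≤-or-≥ m≤n j)

data 𝒯-Word (n : ℕ) : Subset (n + n) → Set where
  pair      : (k : Fin n) → 𝒯-Word n (pairSet n (toℕ k))
  odd       : 𝒯-Word n (oddNeurons n)
  even      : 𝒯-Word n (evenNeurons n)
  singleton : (i : Fin (n + n)) → 𝒯-Word n ⁅ i ⁆
  empty     : 𝒯-Word n ⊥

T-⌊⌋ : ∀ {A : Set} (a? : Dec A) → T ⌊ a? ⌋ ⇔ A
T-⌊⌋ a? = mk⇔ toWitness fromWitness

T-∨-cong : ∀ {x y} {A B : Set} → T x ⇔ A → T y ⇔ B → T (x ∨ y) ⇔ (A ⊎ B)
T-∨-cong {x} x⇔A y⇔B = (x⇔A ⊎-⇔ y⇔B) ⇔-∘ T-∨ {x}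

𝒯-Cases : ∀ n → Subset (n + n) → Set
𝒯-Cases n c = (Σ[ k ∈ Fin n ] c ≡ pairSet n (toℕ k)) ⊎ c ≡ oddNeurons n ⊎ c ≡ evenNeurons n ⊎
              (Σ[ i ∈ Fin (n + n) ] c ≡ ⁅ i ⁆) ⊎ c ≡ ⊥

T-𝒯⇔𝒯-Cases : ∀ n (c : Subset (n + n)) → T (𝒯 n c) ⇔ 𝒯-Cases n c
T-𝒯⇔𝒯-Cases n c =
  T-∨-cong (T-⌊⌋ (any? λ (k : Fin n) → c ≟ˢ pairSet n (toℕ k))) (
  T-∨-cong (T-⌊⌋ (c ≟ˢ oddNeurons n)) (
  T-∨-cong (T-⌊⌋ (c ≟ˢ evenNeurons n)) (
  T-∨-cong (T-⌊⌋ (any? λ (i : Fin (n + n)) → c ≟ˢ ⁅ i ⁆))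
           (T-⌊⌋ (c ≟ˢ ⊥)))))

𝒯-Cases⇔𝒯-Word : ∀ n (c : Subset (n + n)) → 𝒯-Cases n c ⇔ 𝒯-Word n c
𝒯-Cases⇔𝒯-Word n c = mk⇔ to from
  where
  to : ∀ {c} → 𝒯-Cases n c → 𝒯-Word n c
  to (inj₁ (k , refl)) = pair k
  to (inj₂ (inj₁ refl)) = odd
  to (inj₂ (inj₂ (inj₁ refl))) = even
  to (inj₂ (inj₂ (inj₂ (inj₁ (i , refl))))) = singleton i
  to (inj₂ (inj₂ (inj₂ (inj₂ refl)))) = empty
  from : ∀ {c} → 𝒯-Word n c → 𝒯-Cases n c
  from (pair k) = inj₁ (k , refl)
  from odd = inj₂ (inj₁ refl)
  from even = inj₂ (inj₂ (inj₁ refl))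
  from (singleton i) = inj₂ (inj₂ (inj₂ (inj₁ (i , refl))))
  from empty = inj₂ (inj₂ (inj₂ (inj₂ refl)))

T-𝒯⇔𝒯-Word : ∀ n (c : Subset (n + n)) → T (𝒯 n c) ⇔ 𝒯-Word n c
T-𝒯⇔𝒯-Word n c = 𝒯-Cases⇔𝒯-Word n c ⇔-∘ T-𝒯⇔𝒯-Cases n c

/2-< : ∀ {j} n → j < n + n → j / 2 < n
/2-< {j} n j<n+n = m<n*o⇒m/o<n (subst (j <_) n+n≡n*2 j<n+n)
  where
  n+n≡n*2 : n + n ≡ n * 2
  n+n≡n*2 = trans (cong (n +_) (sym (+-identityʳ n))) (*-comm 2 n)

pairSet-≥ : ∀ n {j} → n ≤ j → pairSet n j ≡ ⊥
-- toℕ i / 2 ≡ᵇ j is definitionally does (toℕ i / 2 ≟ j).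
pairSet-≥ n n≤j =
  tabulate-≡⊥ λ i → dec-false (toℕ i / 2 ≟ _) (<⇒≢ (<-≤-trans (/2-< n (toℕ<n i)) n≤j))

module _ (m≤n : m ≤ n) where

  private
    m+m≤n+n : m + m ≤ n + n
    m+m≤n+n = +-mono-≤ m≤n m≤n

  truncate-pairSet : ∀ j → truncate m+m≤n+n (pairSet n j) ≡ pairSet m j
  truncate-pairSet j = truncate-tabulate-toℕ m+m≤n+n (λ i → i / 2 ≡ᵇ j)

  truncate-oddNeurons : truncate m+m≤n+n (oddNeurons n) ≡ oddNeurons m
  truncate-oddNeurons = truncate-tabulate-toℕ m+m≤n+n (λ i → i % 2 ≡ᵇ 0)

  truncate-evenNeurons : truncate m+m≤n+n (evenNeurons n) ≡ evenNeurons m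
  truncate-evenNeurons = truncate-tabulate-toℕ m+m≤n+n (λ i → i % 2 ≡ᵇ 1)

  truncate-𝒯-Word : ∀ {c} → 𝒯-Word n c → 𝒯-Word m (truncate m+m≤n+n c)
  truncate-𝒯-Word (pair k) with inject≤-or-≥ m≤n k
  ... | inj₁ (k′ , refl) = subst (𝒯-Word m)
          (sym (trans (truncate-pairSet _) (cong (pairSet m) (toℕ-inject≤ k′ m≤n)))) (pair k′)
  ... | inj₂ m≤k = subst (𝒯-Word m) (sym (trans (truncate-pairSet _) (pairSet-≥ m m≤k))) empty
  truncate-𝒯-Word odd = subst (𝒯-Word m) (sym truncate-oddNeurons) odd
  truncate-𝒯-Word even = subst (𝒯-Word m) (sym truncate-evenNeurons) even
  truncate-𝒯-Word (singleton j) with inject≤-or-≥ m+m≤n+n j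
  ... | inj₁ (i , refl) = subst (𝒯-Word m) (sym (truncate-⁅inject≤⁆ m+m≤n+n i)) (singleton i)
  ... | inj₂ m+m≤j = subst (𝒯-Word m) (sym (truncate-⁅⁆-≥ m+m≤n+n j m+m≤j)) empty
  truncate-𝒯-Word empty = subst (𝒯-Word m) (sym (truncate-⊥ m+m≤n+n)) empty

  truncate-𝒯-Word-onto : ∀ {d} → 𝒯-Word m d → ∃[ c ] 𝒯-Word n c × truncate m+m≤n+n c ≡ d
  truncate-𝒯-Word-onto (pair k) =
    pairSet n (toℕ k) ,
    subst (𝒯-Word n ∘ pairSet n) (toℕ-inject≤ k m≤n) (pair (inject≤ k m≤n)) ,
    truncate-pairSet _
  truncate-𝒯-Word-onto odd = oddNeurons n , odd , truncate-oddNeurons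
  truncate-𝒯-Word-onto even = evenNeurons n , even , truncate-evenNeurons
  truncate-𝒯-Word-onto (singleton i) =
    ⁅ inject≤ i m+m≤n+n ⁆ , singleton _ , truncate-⁅inject≤⁆ m+m≤n+n i
  truncate-𝒯-Word-onto empty = ⊥ , empty , truncate-⊥ m+m≤n+n

  𝒯-mono : 𝒯 m ≤ᶜ 𝒯 n
  𝒯-mono = Restriction.restrict-≤ᶜ m+m≤n+n truncate-∈ onto
    where
    open Equivalence
    truncate-∈ : ∀ c → T (𝒯 n c) → T (𝒯 m (truncate m+m≤n+n c))
    truncate-∈ c = from (T-𝒯⇔𝒯-Word m _) ∘ truncate-𝒯-Word ∘ to (T-𝒯⇔𝒯-Word n c)
    onto : ∀ d → T (𝒯 m d) → ∃[ c ] T (𝒯 n c) × truncate m+m≤n+n c ≡ d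
    onto d d∈𝒯 with truncate-𝒯-Word-onto (to (T-𝒯⇔𝒯-Word m d) d∈𝒯)
    ... | c , c∈𝒯 , c↦d = c , from (T-𝒯⇔𝒯-Word n c) c∈𝒯 , c↦d

proposition9p8 : ((n : ℕ) → 1 ≤ n → 𝒯 n ≤ᶜ 𝒯 (suc n))
    × ((m n : ℕ) → 1 ≤ m → 1 ≤ n → (𝒯 m ≤ᶜ 𝒯 n) ⊎ (𝒯 n ≤ᶜ 𝒯 m))
proposition9p8 = (λ n _ → 𝒯-mono (n≤1+n n)) , λ m n _ _ → Sum.map 𝒯-mono 𝒯-mono (≤-total m n)
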